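{- For every $y\in Y$ and every $\varepsilon>0$ there exist an integer $k$ and an element $p\in P_k$ such that $p\le y<p+\varepsilon$.
   Context: For $k\ge 0$ let $P_k=\left\{\dfrac{2^{\lceil i\log_2 3\rceil-1}}{3^i}:0\le i<k\right\}$. Let $Y$ be the set of rational numbers $y=x/2^n$, where $x$ is an odd positive integer not divisible by $3$ and $n$ is the number of binary digits of $x$ (so $2^{n-1}\le x<2^n$). Equivalently, $Y$ consists of the $y$ with $1/2\le y<1$ and finite binary representation $y=0.1b_1\dots b_{n-2}1$ such that $y2^n$ is not a multiple of $3$.
   Formalization: The tolerance ε ranges over the positive rationals. -}

module Defs where

open import Data.Nat using (ℕ; _*_; _^_; _<_; NonZero)
open import Data.Nat.Properties using (m^n≢0; m*n≢0)
open import Data.Nat.Logarithm using (⌈log₂_⌉)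
open import Data.Integer using (+_)
open import Data.Rational using (ℚ; _/_)
open import Relation.Binary.PropositionalEquality using (_≡_)

-- ⌈ i log₂ 3 ⌉ = ⌈ log₂ (3^i) ⌉  (stdlib ceiling binary logarithm)
ceilILog3 : ℕ → ℕ
ceilILog3 i = ⌈log₂ (3 ^ i) ⌉

-- p i = 2^(⌈i log₂ 3⌉ - 1) / 3^i  =  2^⌈i log₂ 3⌉ / (2 * 3^i)
-- (written this way since the exponent is -1 when i = 0)
p : ℕ → ℚ
p i = _/_ (+ (2 ^ ceilILog3 i)) (2 * 3 ^ i) {{m*n≢0 2 (3 ^ i) {{_}} {{m^n≢0 3 i}}}}

data _∈P_ (q : ℚ) (k : ℕ) : Set where
  mem : (i : ℕ) → i < k → q ≡ p i → q ∈P k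

{-# OPTIONS --safe #-}
module Submission where

-- Write r i = 2 ^ ⌈i log₂ 3⌉ / 3 ^ i ∈ [1, 2), so that p i = r i / 2 and r (d t) is (r d) ^ t
-- renormalised into [1, 2) by a power of 2. By pigeonhole on the V + 1 buckets ⌊V · r i⌋ ∈ [V, 2V),
-- i ≤ V, two indices i < j give ρ = 2 ^ e / 3 ^ d (d = j − i) with both ρ and 1/ρ below 1 + 1/V.
-- If ρ > 1 the numbers ρ ^ t = r (d t) climb from 1 past 2 by factors below 1 + 1/V, so one of them
-- lies in (2y / (1 + 1/V), 2y]; if ρ < 1 the numbers 2 ρ ^ t = r (d t) descend from 2 in the same
-- way. Either way p (d t) ≤ y < (1 + 1/V) · p (d t) ≤ p (d t) + 1/V; and when y < (1 + 1/V) / 2,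
-- already p 0 = 1/2 works. All fractions are handled over ℕ by cross-multiplication.

module Approximation where

  open import Data.Empty using (⊥-elim)
  open import Data.Fin using (Fin; toℕ; fromℕ<)
  open import Data.Fin.Properties using (pigeonhole; toℕ-fromℕ<)
  open import Data.Nat
  open import Data.Nat.DivMod
  open import Data.Nat.Induction using (<-rec)
  open import Data.Nat.Logarithm
  open import Data.Nat.Properties
  open import Data.Nat.Tactic.RingSolver using (solve-∀)
  open import Data.Product using (∃; ∃₂; _×_; _,_; proj₁; proj₂)
  open import Relation.Binary.Definitions using (tri<; tri≈; tri>)
  open import Relation.Binary.PropositionalEquality
  open import Relation.Nullary using (¬_; yes; no)
  open import Relation.Unary using (Decidable)

  open import Defs

  n≤2^⌈log₂n⌉ : ∀ n → n ≤ 2 ^ ⌈log₂ n ⌉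
  n≤2^⌈log₂n⌉ = <-rec _ bound
    where
    bound : ∀ n → (∀ {m} → m < n → m ≤ 2 ^ ⌈log₂ m ⌉) → n ≤ 2 ^ ⌈log₂ n ⌉
    bound 0 _ = z≤n
    bound 1 _ = s≤s z≤n
    bound n@(suc (suc k)) rec = begin
      n                                 ≡⟨ sym (⌊n/2⌋+⌈n/2⌉≡n n) ⟩
      ⌊ n /2⌋ + ⌈ n /2⌉                 ≤⟨ +-monoˡ-≤ ⌈ n /2⌉ (⌊n/2⌋≤⌈n/2⌉ n) ⟩
      ⌈ n /2⌉ + ⌈ n /2⌉                 ≡⟨ cong (⌈ n /2⌉ +_) (sym (+-identityʳ _)) ⟩
      2 * ⌈ n /2⌉                       ≤⟨ *-monoʳ-≤ 2 (rec (⌈n/2⌉<n k)) ⟩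
      2 * 2 ^ ⌈log₂ ⌈ n /2⌉ ⌉           ≡⟨ cong (λ c → 2 ^ suc c) (⌈log₂⌈n/2⌉⌉≡⌈log₂n⌉∸1 n) ⟩
      2 ^ suc (⌈log₂ n ⌉ ∸ 1)           ≡⟨ cong (2 ^_) (m+[n∸m]≡n 1≤⌈log₂n⌉) ⟩
      2 ^ ⌈log₂ n ⌉                     ∎
      where
      open ≤-Reasoning
      1≤⌈log₂n⌉ : 1 ≤ ⌈log₂ n ⌉
      1≤⌈log₂n⌉ = ⌈log₂⌉-mono-≤ {2} {n} (s≤s (s≤s z≤n))

  2^⌈log₂n⌉<2n : ∀ {n} → 0 < n → 2 ^ ⌈log₂ n ⌉ < 2 * n
  2^⌈log₂n⌉<2n {n} 0<n with ⌈log₂ n ⌉ in eq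
  ... | zero  = *-monoʳ-≤ 2 0<n
  ... | suc c with 2 ^ c <? n
  ...   | yes 2^c<n = *-monoʳ-< 2 2^c<n
  ...   | no  2^c≮n = ⊥-elim (n≮n c (begin-strict
            c              <⟨ n<1+n c ⟩
            suc c          ≡⟨ sym eq ⟩
            ⌈log₂ n ⌉      ≤⟨ ⌈log₂⌉-mono-≤ (≮⇒≥ 2^c≮n) ⟩
            ⌈log₂ 2 ^ c ⌉  ≡⟨ ⌈log₂2^n⌉≡n c ⟩
            c              ∎))
    where open ≤-Reasoning

  record Normalised (A B : ℕ) : Set where
    constructor normalised
    field
      lower : B ≤ A
      upper : A < 2 * B

  ⌈log₂⌉-normalised : ∀ {n} → 0 < n → Normalised (2 ^ ⌈log₂ n ⌉) n
  ⌈log₂⌉-normalised 0<n = normalised (n≤2^⌈log₂n⌉ _) (2^⌈log₂n⌉<2n 0<n)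

  ⌈log₂⌉-unique : ∀ {n k} → Normalised (2 ^ k) n → ⌈log₂ n ⌉ ≡ k
  ⌈log₂⌉-unique {n} {k} (normalised n≤2^k 2^k<2n) with <-cmp ⌈log₂ n ⌉ k
  ... | tri< c<k _ _ = ⊥-elim (<⇒≱ 2^k<2n (begin
        2 * n                 ≤⟨ *-monoʳ-≤ 2 (n≤2^⌈log₂n⌉ n) ⟩
        2 ^ suc ⌈log₂ n ⌉     ≤⟨ ^-monoʳ-≤ 2 c<k ⟩
        2 ^ k                 ∎))
    where open ≤-Reasoning
  ... | tri≈ _ c≡k _ = c≡k
  ... | tri> _ _ k<c = ⊥-elim (<⇒≱ (2^⌈log₂n⌉<2n 0<n) (begin
        2 * n                 ≤⟨ *-monoʳ-≤ 2 n≤2^k ⟩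
        2 ^ suc k             ≤⟨ ^-monoʳ-≤ 2 k<c ⟩
        2 ^ ⌈log₂ n ⌉         ∎))
    where
    open ≤-Reasoning
    0<n : 0 < n
    0<n = *-cancelˡ-< 2 0 n (<-trans (m^n>0 2 k) 2^k<2n)

  3^n%2≡1 : ∀ n → 3 ^ n % 2 ≡ 1
  3^n%2≡1 zero    = refl
  3^n%2≡1 (suc n) = trans (%-distribˡ-* 3 (3 ^ n) 2) (cong (λ r → (1 * r) % 2) (3^n%2≡1 n))

  2^m≢3^n : ∀ m {n} → 0 < n → 2 ^ m ≢ 3 ^ n
  2^m≢3^n zero    {n} 0<n 1≡3^n = <⇒≱ (^-monoʳ-< 3 (s≤s (s≤s z≤n)) 0<n) (≤-reflexive (sym 1≡3^n))
  2^m≢3^n (suc m) {n} _   eq    = 0≢1+n (begin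
    0                  ≡⟨ sym (m*n%n≡0 (2 ^ m) 2) ⟩
    (2 ^ m * 2) % 2    ≡⟨ cong (_% 2) (trans (*-comm (2 ^ m) 2) eq) ⟩
    3 ^ n % 2          ≡⟨ 3^n%2≡1 n ⟩
    1                  ∎)
    where open ≡-Reasoning

  -- (1 + 1/a)ⁿ ≥ 1 + n/a, cleared of denominators.
  bernoulli : ∀ a n → a ^ n * (a + n) ≤ a * (1 + a) ^ n
  bernoulli a zero    = ≤-reflexive (trans (*-identityˡ (a + 0)) (trans (+-identityʳ a) (sym (*-identityʳ a))))
  bernoulli a (suc n) = begin
    a * a ^ n * (a + suc n)                ≡⟨ e₁ a (a ^ n) n ⟩
    a ^ n * (a * (a + suc n))              ≤⟨ *-monoʳ-≤ (a ^ n) (m≤m+n _ n) ⟩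
    a ^ n * (a * (a + suc n) + n)          ≡⟨ e₂ a (a ^ n) n ⟩
    a ^ n * (a + n) * (1 + a)              ≤⟨ *-monoˡ-≤ (1 + a) (bernoulli a n) ⟩
    a * (1 + a) ^ n * (1 + a)              ≡⟨ e₃ a ((1 + a) ^ n) ⟩
    a * ((1 + a) * (1 + a) ^ n)            ∎
    where
    open ≤-Reasoning
    e₁ : ∀ a A n → a * A * (a + suc n) ≡ A * (a * (a + suc n))
    e₁ = solve-∀
    e₂ : ∀ a A n → A * (a * (a + suc n) + n) ≡ A * (a + n) * (1 + a)
    e₂ = solve-∀
    e₃ : ∀ a B → a * B * (1 + a) ≡ a * ((1 + a) * B)
    e₃ = solve-∀

  2*m^m≤n^m : ∀ {m n} → 0 < m → m < n → 2 * m ^ m ≤ n ^ m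
  2*m^m≤n^m {m} {n} 0<m m<n = ≤-trans (*-cancelˡ-≤ m {{>-nonZero 0<m}} (begin
    m * (2 * m ^ m)       ≡⟨ e m (m ^ m) ⟩
    m ^ m * (m + m)       ≤⟨ bernoulli m m ⟩
    m * (1 + m) ^ m       ∎)) (^-monoˡ-≤ m m<n)
    where
    open ≤-Reasoning
    e : ∀ m M → m * (2 * M) ≡ M * (m + m)
    e = solve-∀

  crossing : ∀ {P : ℕ → Set} → Decidable P → P 0 → ∀ n → ¬ P n → ∃ λ t → P t × ¬ P (suc t)
  crossing P? P0 zero    ¬P0 = ⊥-elim (¬P0 P0)
  crossing P? P0 (suc n) ¬Pn with P? n
  ... | yes Pn  = n , Pn , ¬Pn
  ... | no  ¬Pn = crossing P? P0 n ¬Pn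

  m<[1+m/n]*n : ∀ m n .{{_ : NonZero n}} → m < (1 + m / n) * n
  m<[1+m/n]*n m n = begin-strict
    m                    ≡⟨ m≡m%n+[m/n]*n m n ⟩
    m % n + m / n * n    <⟨ +-monoˡ-< (m / n * n) (m%n<n m n) ⟩
    n + m / n * n        ∎
    where open ≤-Reasoning

  -- ⌊V · A / B⌋ = ⌊V · C / D⌋ with C / D ≥ 1 gives A / B < (1 + 1/V) · C / D.
  floors-close : ∀ V A B C D .{{_ : NonZero B}} .{{_ : NonZero D}} →
                 D ≤ C → A * V / B ≡ C * V / D → V * A * D < (1 + V) * C * B
  floors-close V A B C D D≤C eq = begin-strict
    V * A * D                  ≡⟨ e₁ V A D ⟩
    A * V * D                  <⟨ *-monoˡ-< D (m<[1+m/n]*n (A * V) B) ⟩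
    (1 + A * V / B) * B * D    ≡⟨ cong (λ q → (1 + q) * B * D) eq ⟩
    (1 + q) * B * D            ≡⟨ e₂ q B D ⟩
    q * D * B + D * B          ≤⟨ +-mono-≤ (*-monoˡ-≤ B (m/n*n≤m (C * V) D)) (*-monoˡ-≤ B D≤C) ⟩
    C * V * B + C * B          ≡⟨ e₃ C V B ⟩
    (1 + V) * C * B            ∎
    where
    open ≤-Reasoning
    q = C * V / D
    e₁ : ∀ V A D → V * A * D ≡ A * V * D
    e₁ = solve-∀
    e₂ : ∀ q B D → (1 + q) * B * D ≡ q * D * B + D * B
    e₂ = solve-∀
    e₃ : ∀ C V B → C * V * B + C * B ≡ (1 + V) * C * B
    e₃ = solve-∀

  normalised-floor : ∀ {A B} V .{{_ : NonZero V}} .{{_ : NonZero B}} →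
                     Normalised A B → V ≤ A * V / B × A * V / B < 2 * V
  normalised-floor {A} {B} V (normalised B≤A A<2B) = lower , m<n*o⇒m/o<n upper
    where
    open ≤-Reasoning
    lower : V ≤ A * V / B
    lower = begin
      V           ≡⟨ sym (m*n/n≡m V B) ⟩
      V * B / B   ≡⟨ cong (_/ B) (*-comm V B) ⟩
      B * V / B   ≤⟨ /-monoˡ-≤ B (*-monoˡ-≤ V B≤A) ⟩
      A * V / B   ∎
    upper : A * V < 2 * V * B
    upper = begin-strict
      A * V       <⟨ *-monoˡ-< V A<2B ⟩
      2 * B * V   ≡⟨ e B V ⟩
      2 * V * B   ∎
      where
      e : ∀ B V → 2 * B * V ≡ 2 * V * B
      e = solve-∀

  m^n≡m^k*m^[n∸k] : ∀ m {k n} → k ≤ n → m ^ n ≡ m ^ k * m ^ (n ∸ k)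
  m^n≡m^k*m^[n∸k] m {k} {n} k≤n = trans (cong (m ^_) (sym (m+[n∸m]≡n k≤n))) (^-distribˡ-+-* m k (n ∸ k))

  equal-floors⇒close : ∀ {V P S a b} A B .{{_ : NonZero S}} .{{_ : NonZero B}} →
                       A ≡ P * a → B ≡ S * b → S ≤ P → B ≤ A → P * V / S ≡ A * V / B →
                       V * a < (1 + V) * b × V * b < (1 + V) * a
  equal-floors⇒close {V} {P} {S} {a} {b} _ _ refl refl S≤P Sb≤Pa eq =
      *-cancelʳ-< (P * S) (V * a) ((1 + V) * b)
        (subst₂ _<_ (e₁ V P S a) (e₂ V P S b) (floors-close V (P * a) (S * b) P S S≤P (sym eq)))
    , *-cancelʳ-< (P * S) (V * b) ((1 + V) * a)
        (subst₂ _<_ (e₃ V P S b) (e₄ V P S a) (floors-close V P S (P * a) (S * b) Sb≤Pa eq))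
    where
    e₁ : ∀ V P S a → V * (P * a) * S ≡ V * a * (P * S)
    e₁ = solve-∀
    e₂ : ∀ V P S b → (1 + V) * P * (S * b) ≡ (1 + V) * b * (P * S)
    e₂ = solve-∀
    e₃ : ∀ V P S b → V * P * (S * b) ≡ V * b * (P * S)
    e₃ = solve-∀
    e₄ : ∀ V P S a → (1 + V) * (P * a) * S ≡ (1 + V) * a * (P * S)
    e₄ = solve-∀

  normalised-index : ∀ i → Normalised (2 ^ ceilILog3 i) (3 ^ i)
  normalised-index i = ⌈log₂⌉-normalised (m^n>0 3 i)

  module _ (V : ℕ) .{{V≢0 : NonZero V}} where

    bucket : ℕ → ℕ
    bucket i = (2 ^ ceilILog3 i * V / 3 ^ i) {{m^n≢0 3 i}}

    V≤bucket : ∀ i → V ≤ bucket i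
    V≤bucket i = proj₁ (normalised-floor V {{V≢0}} {{m^n≢0 3 i}} (normalised-index i))

    bucket∸V<V : ∀ i → bucket i ∸ V < V
    bucket∸V<V i = m<n+o⇒m∸n<o (bucket i) V (subst (bucket i <_) (cong (V +_) (+-identityʳ V))
      (proj₂ (normalised-floor V {{V≢0}} {{m^n≢0 3 i}} (normalised-index i))))

    slot : Fin (suc V) → Fin V
    slot k = fromℕ< (bucket∸V<V (toℕ k))

    slot≡⇒bucket≡ : ∀ k l → slot k ≡ slot l → bucket (toℕ k) ≡ bucket (toℕ l)
    slot≡⇒bucket≡ k l same = ∸-cancelʳ-≡ (V≤bucket (toℕ k)) (V≤bucket (toℕ l)) (begin
      bucket (toℕ k) ∸ V   ≡⟨ toℕ-fromℕ< _ ⟨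
      toℕ (slot k)         ≡⟨ cong toℕ same ⟩
      toℕ (slot l)         ≡⟨ toℕ-fromℕ< _ ⟩
      bucket (toℕ l) ∸ V   ∎)
      where open ≡-Reasoning

    bucket-collision : ∃₂ λ i j → i < j × bucket i ≡ bucket j
    bucket-collision =
      let k , l , k<l , same = pigeonhole (n<1+n V) slot
      in toℕ k , toℕ l , k<l , slot≡⇒bucket≡ k l same

    close-pair : ∃₂ λ d e → 0 < d × V * 2 ^ e < (1 + V) * 3 ^ d × V * 3 ^ d < (1 + V) * 2 ^ e
    close-pair =
      let i , j , i<j , same = bucket-collision
          ⌈i⌉≤⌈j⌉ = ⌈log₂⌉-mono-≤ (^-monoʳ-≤ 3 (<⇒≤ i<j))
      in  j ∸ i , ceilILog3 j ∸ ceilILog3 i , m<n⇒0<n∸m i<j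
        , equal-floors⇒close (2 ^ ceilILog3 j) (3 ^ j) {{m^n≢0 3 i}} {{m^n≢0 3 j}}
            (m^n≡m^k*m^[n∸k] 2 ⌈i⌉≤⌈j⌉) (m^n≡m^k*m^[n∸k] 3 (<⇒≤ i<j))
            (Normalised.lower (normalised-index i)) (Normalised.lower (normalised-index j)) same

  -- P / Q ≤ x / W < (1 + 1/V) · P / Q
  record Approximates (V P Q x W : ℕ) : Set where
    constructor approximates
    field
      below  : P * W ≤ x * Q
      within : x * Q * V < P * (1 + V) * W

  step-within : ∀ {V a b x P Q W} .{{_ : NonZero V}} →
                V * a < (1 + V) * b → x * Q * b < a * P * W → x * Q * V < P * (1 + V) * W
  step-within {V} {a} {b} {x} {P} {Q} {W} close next = *-cancelˡ-< b _ _ (begin-strict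
    b * (x * Q * V)          ≡⟨ e₁ b x Q V ⟩
    x * Q * b * V            <⟨ *-monoˡ-< V next ⟩
    a * P * W * V            ≡⟨ e₂ a P W V ⟩
    P * W * (V * a)          ≤⟨ *-monoʳ-≤ (P * W) (<⇒≤ close) ⟩
    P * W * ((1 + V) * b)    ≡⟨ e₃ P W V b ⟩
    b * (P * (1 + V) * W)    ∎)
    where
    open ≤-Reasoning
    e₁ : ∀ b x Q V → b * (x * Q * V) ≡ x * Q * b * V
    e₁ = solve-∀
    e₂ : ∀ a P W V → a * P * W * V ≡ P * W * (V * a)
    e₂ = solve-∀
    e₃ : ∀ P W V b → P * W * ((1 + V) * b) ≡ b * (P * (1 + V) * W)
    e₃ = solve-∀

  approximates⇒Q<2P : ∀ {V P Q x W} → Approximates V P Q x W → (1 + V) * W ≤ 2 * x * V → Q < 2 * P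
  approximates⇒Q<2P {V} {P} {Q} {x} {W} (approximates _ within) large =
    *-cancelʳ-< (2 * x * V) Q (2 * P) (begin-strict
    Q * (2 * x * V)          ≡⟨ e₁ Q x V ⟩
    2 * (x * Q * V)          <⟨ *-monoʳ-< 2 within ⟩
    2 * (P * (1 + V) * W)    ≡⟨ e₂ P V W ⟩
    2 * P * ((1 + V) * W)    ≤⟨ *-monoʳ-≤ (2 * P) large ⟩
    2 * P * (2 * x * V)      ∎)
    where
    open ≤-Reasoning
    e₁ : ∀ Q x V → Q * (2 * x * V) ≡ 2 * (x * Q * V)
    e₁ = solve-∀
    e₂ : ∀ P V W → 2 * (P * (1 + V) * W) ≡ 2 * P * ((1 + V) * W)
    e₂ = solve-∀

  walk-up : ∀ {V a b x W} .{{_ : NonZero V}} → 0 < b → b < a → V * a < (1 + V) * b →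
            W ≤ 2 * x → x < W → ∃ λ t → Normalised (a ^ t) (b ^ t) × Approximates V (a ^ t) (2 * b ^ t) x W
  walk-up {V} {a} {b} {x} {W} 0<b b<a close W≤2x x<W =
    let t , below , ¬below = crossing (λ t → a ^ t * W ≤? x * (2 * b ^ t)) initially b eventually-fails
    in  t , normalised-at t below , approximates below (upper t ¬below)
    where
    open ≤-Reasoning
    initially : 1 * W ≤ x * (2 * 1)
    initially = begin
      1 * W        ≡⟨ *-identityˡ W ⟩
      W            ≤⟨ W≤2x ⟩
      2 * x        ≡⟨ *-comm 2 x ⟩
      x * 2        ∎
    eventually-fails : ¬ (a ^ b * W ≤ x * (2 * b ^ b))
    eventually-fails below = <⇒≱ (begin-strict
      x * (2 * b ^ b)    <⟨ *-monoˡ-< (2 * b ^ b) {{>-nonZero (*-monoʳ-< 2 (m^n>0 b {{>-nonZero 0<b}} b))}} x<W ⟩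
      W * (2 * b ^ b)    ≤⟨ *-monoʳ-≤ W (2*m^m≤n^m 0<b b<a) ⟩
      W * a ^ b          ≡⟨ *-comm W (a ^ b) ⟩
      a ^ b * W          ∎) below
    normalised-at : ∀ t → a ^ t * W ≤ x * (2 * b ^ t) → Normalised (a ^ t) (b ^ t)
    normalised-at t below = normalised (^-monoˡ-≤ t (<⇒≤ b<a)) (*-cancelʳ-< W (a ^ t) (2 * b ^ t) (begin-strict
      a ^ t * W          ≤⟨ below ⟩
      x * (2 * b ^ t)    <⟨ *-monoˡ-< (2 * b ^ t) {{>-nonZero (*-monoʳ-< 2 (m^n>0 b {{>-nonZero 0<b}} t))}} x<W ⟩
      W * (2 * b ^ t)    ≡⟨ *-comm W (2 * b ^ t) ⟩
      2 * b ^ t * W      ∎))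
    upper : ∀ t → ¬ (a ^ suc t * W ≤ x * (2 * b ^ suc t)) → x * (2 * b ^ t) * V < a ^ t * (1 + V) * W
    upper t ¬below = step-within {x = x} {Q = 2 * b ^ t} close (subst (_< a * a ^ t * W) (e x b (b ^ t)) (≰⇒> ¬below))
      where
      e : ∀ x b B → x * (2 * (b * B)) ≡ x * (2 * B) * b
      e = solve-∀

  walk-down : ∀ {V a b x W} .{{_ : NonZero V}} → 0 < a → a < b → V * b < (1 + V) * a →
              (1 + V) * W ≤ 2 * x * V → x < W →
              ∃ λ t → Normalised (2 * a ^ t) (b ^ t) × Approximates V (2 * a ^ t) (2 * b ^ t) x W
  walk-down {V} {a} {b} {x} {W} 0<a a<b close large x<W =
    let t , above , ¬above = crossing (λ t → x * b ^ t <? a ^ t * W) initially a eventually-fails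
        approx = approximates (lower t ¬above) (upper t above)
    in  suc t , normalised-at t approx , approx
    where
    open ≤-Reasoning
    initially : x * 1 < 1 * W
    initially = subst₂ _<_ (sym (*-identityʳ x)) (sym (*-identityˡ W)) x<W
    W≤2x : W ≤ 2 * x
    W≤2x = *-cancelˡ-≤ V (begin
      V * W            ≤⟨ *-monoˡ-≤ W (n≤1+n V) ⟩
      (1 + V) * W      ≤⟨ large ⟩
      2 * x * V        ≡⟨ *-comm (2 * x) V ⟩
      V * (2 * x)      ∎)
    eventually-fails : ¬ (x * b ^ a < a ^ a * W)
    eventually-fails above = <⇒≱ above (begin
      a ^ a * W          ≤⟨ *-monoʳ-≤ (a ^ a) W≤2x ⟩
      a ^ a * (2 * x)    ≡⟨ e (a ^ a) x ⟩
      x * (2 * a ^ a)    ≤⟨ *-monoʳ-≤ x (2*m^m≤n^m 0<a a<b) ⟩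
      x * b ^ a          ∎)
      where
      e : ∀ A x → A * (2 * x) ≡ x * (2 * A)
      e = solve-∀
    lower : ∀ t → ¬ (x * b ^ suc t < a ^ suc t * W) → 2 * a ^ suc t * W ≤ x * (2 * b ^ suc t)
    lower t ¬above = begin
      2 * a ^ suc t * W      ≡⟨ *-assoc 2 (a ^ suc t) W ⟩
      2 * (a ^ suc t * W)    ≤⟨ *-monoʳ-≤ 2 (≮⇒≥ ¬above) ⟩
      2 * (x * b ^ suc t)    ≡⟨ e x (b ^ suc t) ⟩
      x * (2 * b ^ suc t)    ∎
      where
      e : ∀ x B → 2 * (x * B) ≡ x * (2 * B)
      e = solve-∀
    upper : ∀ t → x * b ^ t < a ^ t * W → x * (2 * b ^ suc t) * V < 2 * a ^ suc t * (1 + V) * W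
    upper t above = step-within {x = x} {Q = 2 * b ^ suc t} close (begin-strict
      x * (2 * b ^ suc t) * a      ≡⟨ e₁ x b (b ^ t) a ⟩
      2 * a * b * (x * b ^ t)      <⟨ *-monoʳ-< (2 * a * b) {{>-nonZero 0<2ab}} above ⟩
      2 * a * b * (a ^ t * W)      ≡⟨ e₂ a b (a ^ t) W ⟩
      b * (2 * a ^ suc t) * W      ∎)
      where
      0<2ab : 0 < 2 * a * b
      0<2ab = *-mono-< (*-monoʳ-< 2 0<a) (<-trans 0<a a<b)
      e₁ : ∀ x b B a → x * (2 * (b * B)) * a ≡ 2 * a * b * (x * B)
      e₁ = solve-∀
      e₂ : ∀ a b A W → 2 * a * b * (A * W) ≡ b * (2 * (a * A)) * W
      e₂ = solve-∀
    normalised-at : ∀ t → Approximates V (2 * a ^ suc t) (2 * b ^ suc t) x W →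
                    Normalised (2 * a ^ suc t) (b ^ suc t)
    normalised-at t approx = normalised
      (<⇒≤ (*-cancelˡ-< 2 (b ^ suc t) (2 * a ^ suc t) (approximates⇒Q<2P approx large)))
      (*-monoʳ-< 2 (^-monoˡ-< (suc t) a<b))

  approximation-at : ∀ {V x W A B} m i → A ≡ 2 ^ m → B ≡ 3 ^ i → Normalised A B →
                     Approximates V A (2 * B) x W → Approximates V (2 ^ ceilILog3 i) (2 * 3 ^ i) x W
  approximation-at {V} {x} {W} m i refl refl norm approx =
    subst (λ k → Approximates V (2 ^ k) (2 * 3 ^ i) x W) (sym (⌈log₂⌉-unique {k = m} norm)) approx

  approximation-from-close-pair : ∀ {V x W} d e .{{_ : NonZero V}} → 0 < d →
    V * 2 ^ e < (1 + V) * 3 ^ d → V * 3 ^ d < (1 + V) * 2 ^ e →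
    (1 + V) * W ≤ 2 * x * V → W ≤ 2 * x → x < W →
    ∃ λ i → Approximates V (2 ^ ceilILog3 i) (2 * 3 ^ i) x W
  approximation-from-close-pair {V} {x} {W} d e 0<d up down large W≤2x x<W with <-cmp (2 ^ e) (3 ^ d)
  ... | tri< 2^e<3^d _ _ =
    let t , norm , approx = walk-down (m^n>0 2 e) 2^e<3^d down large x<W
    in  d * t , approximation-at (suc (e * t)) (d * t) (cong (2 *_) (^-*-assoc 2 e t)) (^-*-assoc 3 d t)
                  norm approx
  ... | tri≈ _ 2^e≡3^d _ = ⊥-elim (2^m≢3^n e 0<d 2^e≡3^d)
  ... | tri> _ _ 3^d<2^e =
    let t , norm , approx = walk-up (m^n>0 3 d) 3^d<2^e up W≤2x x<W
    in  d * t , approximation-at (e * t) (d * t) (^-*-assoc 2 e t) (^-*-assoc 3 d t) norm approx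

  approximation : ∀ x n V .{{_ : NonZero V}} → 2 ^ (n ∸ 1) ≤ x → x < 2 ^ n →
                  ∃ λ i → Approximates V (2 ^ ceilILog3 i) (2 * 3 ^ i) x (2 ^ n)
  approximation x zero    V lo hi = ⊥-elim (<⇒≱ hi lo)
  approximation x (suc n) V lo hi with (1 + V) * 2 ^ suc n ≤? 2 * x * V
  ... | yes large =
    let d , e , 0<d , up , down = close-pair V
    in  approximation-from-close-pair d e 0<d up down large W≤2x hi
    where
    W≤2x : 2 ^ suc n ≤ 2 * x
    W≤2x = *-monoʳ-≤ 2 lo
  ... | no small = 0 , approximates below within
    where
    below : 1 * 2 ^ suc n ≤ x * 2
    below = subst₂ _≤_ (sym (*-identityˡ (2 ^ suc n))) (*-comm 2 x) (*-monoʳ-≤ 2 lo)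
    within : x * 2 * V < 1 * (1 + V) * 2 ^ suc n
    within = subst₂ _<_ (cong (_* V) (*-comm 2 x)) (cong (_* 2 ^ suc n) (sym (*-identityˡ (1 + V))))
      (≰⇒> small)

  approximates⇒<+ε : ∀ {V P Q x W} u → P ≤ Q → Approximates V P Q x W →
                     x * (Q * V) < (P * V + suc u * Q) * W
  approximates⇒<+ε {V} {P} {Q} {x} {W} u P≤Q (approximates _ within) = begin-strict
    x * (Q * V)              ≡⟨ *-assoc x Q V ⟨
    x * Q * V                <⟨ within ⟩
    P * (1 + V) * W          ≡⟨ cong (_* W) (*-comm P (1 + V)) ⟩
    (P + V * P) * W          ≡⟨ cong (λ y → (P + y) * W) (*-comm V P) ⟩
    (P + P * V) * W          ≡⟨ cong (_* W) (+-comm P (P * V)) ⟩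
    (P * V + P) * W          ≤⟨ *-monoˡ-≤ W (+-monoʳ-≤ (P * V) (≤-trans P≤Q (m≤n*m Q (suc u)))) ⟩
    (P * V + suc u * Q) * W  ∎
    where open ≤-Reasoning

module FractionOrder where
  open import Data.Nat as ℕ using (ℕ; suc; NonZero)
  open import Data.Nat.Coprimality using (Coprime)
  open import Data.Integer as ℤ using (+_; +[1+_])
  import Data.Integer.Properties as ℤP
  open import Data.Rational using (mkℚ; _/_; _+_; _≤_; _<_; toℚᵘ)
  open import Data.Rational.Properties using (toℚᵘ-fromℚᵘ; toℚᵘ-cancel-≤; toℚᵘ-cancel-<; toℚᵘ-homo-+)
  import Data.Rational.Unnormalised as ℚᵘ
  import Data.Rational.Unnormalised.Properties as ℚᵘP
  open import Relation.Binary.PropositionalEquality using (_≡_; cong; cong₂; subst₂; trans)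

  toℚᵘ-/ : ∀ n d .{{_ : NonZero d}} → toℚᵘ (+ n / d) ℚᵘ.≃ ℚᵘ.mkℚᵘ (+ n) (ℕ.pred d)
  toℚᵘ-/ n (suc d) = toℚᵘ-fromℚᵘ (ℚᵘ.mkℚᵘ (+ n) d)

  cross-≤⇒/≤/ : ∀ a b c d .{{_ : NonZero b}} .{{_ : NonZero d}} → a ℕ.* d ℕ.≤ c ℕ.* b → + a / b ≤ + c / d
  cross-≤⇒/≤/ a b@(suc _) c d@(suc _) ad≤cb =
    toℚᵘ-cancel-≤ (ℚᵘP.≤-respʳ-≃ (ℚᵘP.≃-sym (toℚᵘ-/ c d)) (ℚᵘP.≤-respˡ-≃ (ℚᵘP.≃-sym (toℚᵘ-/ a b))
      (ℚᵘ.*≤* (subst₂ ℤ._≤_ (ℤP.pos-* a d) (ℤP.pos-* c b) (ℤ.+≤+ ad≤cb)))))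

  cross-<⇒/</+ : ∀ a b c d u v .(coprime : Coprime (suc u) (suc v)) .{{_ : NonZero b}} .{{_ : NonZero d}} →
                 c ℕ.* (b ℕ.* suc v) ℕ.< (a ℕ.* suc v ℕ.+ suc u ℕ.* b) ℕ.* d →
                 + c / d < + a / b + mkℚ +[1+ u ] v coprime
  cross-<⇒/</+ a b@(suc _) c d@(suc _) u v coprime lt =
    toℚᵘ-cancel-< (ℚᵘP.<-respʳ-≃ (ℚᵘP.≃-sym (toℚᵘ-homo-+ (+ a / b) ε))
      (ℚᵘP.<-respʳ-≃ (ℚᵘP.+-congˡ (toℚᵘ ε) (ℚᵘP.≃-sym (toℚᵘ-/ a b)))
        (ℚᵘP.<-respˡ-≃ (ℚᵘP.≃-sym (toℚᵘ-/ c d)) (ℚᵘ.*<* (subst₂ ℤ._<_ lhs rhs (ℤ.+<+ lt))))))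
    where
    ε = mkℚ +[1+ u ] v coprime
    lhs : + (c ℕ.* (b ℕ.* suc v)) ≡ + c ℤ.* + (b ℕ.* suc v)
    lhs = ℤP.pos-* c (b ℕ.* suc v)
    rhs : + ((a ℕ.* suc v ℕ.+ suc u ℕ.* b) ℕ.* d) ≡ (+ a ℤ.* + suc v ℤ.+ + suc u ℤ.* + b) ℤ.* + d
    rhs = trans (ℤP.pos-* (a ℕ.* suc v ℕ.+ suc u ℕ.* b) d) (cong (ℤ._* + d)
            (trans (ℤP.pos-+ (a ℕ.* suc v) (suc u ℕ.* b)) (cong₂ ℤ._+_ (ℤP.pos-* a (suc v)) (ℤP.pos-* (suc u) b))))

open import Defs
open import Data.Nat using (ℕ; _^_; _∸_; _≤_; _<_)
open import Data.Nat.Divisibility using (_∣_)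
open import Data.Integer using (+_)
open import Data.Product using (Σ; _×_; _,_)
open import Relation.Nullary using (¬_)
open import Data.Rational using (ℚ; _/_; _+_; Positive)
open import Data.Nat.Properties using (m^n≢0)

open import Data.Nat using (suc; _*_)
open import Data.Nat.Properties using (m*n≢0; n<1+n; <⇒≤)
open import Data.Integer using (+[1+_])
open import Data.Rational using (mkℚ)
open import Relation.Binary.PropositionalEquality using (refl)
open Approximation using (module Normalised; normalised-index; module Approximates; approximation; approximates⇒<+ε)
open FractionOrder using (cross-≤⇒/≤/; cross-<⇒/</+)

lemma6 : (x n : ℕ) → ¬ (2 ∣ x) → ¬ (3 ∣ x) → 2 ^ (n ∸ 1) ≤ x → x < 2 ^ n →
    (ε : ℚ) → Positive ε →
    Σ ℕ λ k → Σ ℚ λ q → q ∈P k ×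
    (q Data.Rational.≤ (+ x / 2 ^ n) {{m^n≢0 2 n}}) ×
    ((+ x / 2 ^ n) {{m^n≢0 2 n}} Data.Rational.< q + ε)
lemma6 x n _ _ lo hi (mkℚ +[1+ u ] v coprime) _ =
  let i , approx = approximation x n (suc v) lo hi
      2·3^i≢0 = m*n≢0 2 (3 ^ i) {{_}} {{m^n≢0 3 i}}
  in  suc i , p i , mem i (n<1+n i) refl
    , cross-≤⇒/≤/ (2 ^ ceilILog3 i) (2 * 3 ^ i) x (2 ^ n) {{2·3^i≢0}} {{m^n≢0 2 n}}
        (Approximates.below approx)
    , cross-<⇒/</+ (2 ^ ceilILog3 i) (2 * 3 ^ i) x (2 ^ n) u v coprime {{2·3^i≢0}} {{m^n≢0 2 n}}
        (approximates⇒<+ε u (<⇒≤ (Normalised.upper (normalised-index i))) approx)
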